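{- Let $T$ be a countable tree, $T^+$ its ramification completion and $I$ the unary predicate on $T^+$ for the irrational points $T^+\setminus T$. If $(T^+,<,I)$ is $\aleph_0$-categorical, then for every maximal chain $L$ of $T^+$ the coloured linear order $(L,<,I)$ (with $I$ restricted to $L$) is $\aleph_0$-categorical.
   Context: A tree is a partial order $(T,\leq)$ such that for all $x,y,z$, if $x,y\leq z$ then $x\leq y$ or $y\leq x$, and for all $x,y$ there is $z$ with $z\leq x,y$. For $x,y$ in a tree, $x\wedge y:=\sup\{t : t\leq x,y\}$. A tree is ramification complete if it contains $x\wedge y$ for all of its elements $x,y$. The ramification completion $T^+$ of $T$ is the smallest ramification complete tree containing $T$ as a substructure; elements of $T^+\setminus T$ are irrational. A countable structure is $\aleph_0$-categorical if it is the unique countable model of its first-order theory (equivalently, its automorphism group has finitely many orbits on $n$-tuples for each $n$). -}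

module Defs where

open import Data.Nat using (ℕ)
open import Data.Fin using (Fin)
open import Data.Bool using (Bool; true)
open import Data.List using (List)
open import Data.List.Relation.Unary.Any using (Any)
open import Data.Product using (Σ; ∃; ∃₂; _×_; proj₁)
open import Data.Sum using (_⊎_)
open import Relation.Nullary using (¬_)
open import Relation.Binary.PropositionalEquality using (_≡_; _≢_)
open import Relation.Binary.Structures using (IsPartialOrder)
open import Function using (_↔_; _⇔_; Inverse)
open import Function.Definitions using (Injective)

record Tree : Set₁ where
  field
    Carrier        : Set
    _≤_            : Carrier → Carrier → Set
    isPartialOrder : IsPartialOrder _≡_ _≤_
    downChain      : ∀ x y z → x ≤ z → y ≤ z → (x ≤ y) ⊎ (y ≤ x)
    directed       : ∀ x y → ∃ λ z → (z ≤ x) × (z ≤ y)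

  _<_ : Carrier → Carrier → Set
  x < y = (x ≤ y) × (x ≢ y)

|C| : Tree → Set
|C| = Tree.Carrier

Countable : Set → Set
Countable A = ∃ λ (f : A → ℕ) → Injective _≡_ _≡_ f

module _ (S : Tree) where
  open Tree S

  IsMeet : Carrier → Carrier → Carrier → Set
  IsMeet x y m = (m ≤ x) × (m ≤ y) × (∀ t → t ≤ x → t ≤ y → t ≤ m)

  IsSup : (Carrier → Set) → Carrier → Set
  IsSup X m = (∀ s → X s → s ≤ m) × (∀ u → (∀ s → X s → s ≤ u) → m ≤ u)

  RamificationComplete : Set
  RamificationComplete = ∀ x y → ∃ λ m → IsMeet x y m

  IsChain : (Carrier → Bool) → Set
  IsChain C = ∀ x y → C x ≡ true → C y ≡ true → (x ≤ y) ⊎ (y ≤ x)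

  IsMaximalChain : (Carrier → Bool) → Set
  IsMaximalChain C =
    IsChain C ×
    (∀ (C' : Carrier → Bool) → IsChain C' →
       (∀ x → C x ≡ true → C' x ≡ true) → ∀ x → C' x ≡ true → C x ≡ true)

-- (S , e) is the ramification completion T⁺ of T:
--  e embeds T as a substructure of S, S is ramification complete,
--  for x,y ∈ T the meet x ∧ y in S is sup{ t ∈ T : t ≤ x , y },
--  and S is the smallest such tree: every point of S is such a meet.
record IsRamificationCompletion (T S : Tree) (e : |C| T → |C| S) : Set where
  private
    module T = Tree T
    module S = Tree S
  field
    embedding : ∀ x y → (x T.≤ y → e x S.≤ e y) × (e x S.≤ e y → x T.≤ y)
    complete  : RamificationComplete S
    meetIsSup : ∀ x y m → IsMeet S (e x) (e y) m →
                IsSup S (λ s → ∃ λ t → (t T.≤ x) × (t T.≤ y) × (e t ≡ s)) m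
    generated : ∀ s → ∃₂ λ x y → IsMeet S (e x) (e y) s

Irrational : {T S : Tree} → (|C| T → |C| S) → |C| S → Set
Irrational e s = ¬ (∃ λ x → e x ≡ s)

IsAutomorphism : {A : Set} → (A → A → Set) → (A → Set) → A ↔ A → Set
IsAutomorphism {A} _<_ P σ =
  (∀ x y → (x < y) ⇔ (Inverse.to σ x < Inverse.to σ y)) ×
  (∀ x → P x ⇔ P (Inverse.to σ x))

-- ℵ₀-categoricity of a countable structure (A , < , P), via
-- Ryll-Nardzewski: finitely many Aut-orbits on n-tuples for every n.
Aleph0Categorical : (A : Set) → (A → A → Set) → (A → Set) → Set
Aleph0Categorical A _<_ P =
  ∀ (n : ℕ) → ∃ λ (reps : List (Fin n → A)) →
    ∀ (a : Fin n → A) → ∃ λ (σ : A ↔ A) →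
      IsAutomorphism _<_ P σ ×
      Any (λ r → ∀ i → Inverse.to σ (a i) ≡ r i) reps

-- the coloured linear order (L , < , I ∩ L) for a subset L of S
SubCarrier : (S : Tree) → (|C| S → Bool) → Set
SubCarrier S L = Σ (|C| S) (λ x → L x ≡ true)

SubLt : (S : Tree) (L : |C| S → Bool) → SubCarrier S L → SubCarrier S L → Set
SubLt S L x y = Tree._<_ S (proj₁ x) (proj₁ y)

SubPred : (S : Tree) (L : |C| S → Bool) → (|C| S → Set) → SubCarrier S L → Set
SubPred S L P x = P (proj₁ x)

-- T⁺ is countable, since each of its points is the meet of two points of T. Hence a maximal
-- chain L has a cofinal non-decreasing sequence, and by Ramsey's theorem on the finitely many
-- Aut(T⁺)-orbits of pairs we may take it so that all pairs of consecutive terms lie in one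
-- orbit. Given a tuple ā of L below a term e_K, the orbit of (e_K, ā) in T⁺ is one of finitely
-- many. If (e_K, ā) and (e_M, b̄) lie in the same orbit, an automorphism of T⁺ mapping one to
-- the other can be continued block by block, using automorphisms of T⁺ that carry
-- (e_{K+j}, e_{K+j+1}) to (e_{M+j}, e_{M+j+1}), into an automorphism of (L, <, I) sending ā to
-- b̄. So L has finitely many orbits on n-tuples.
module Submission where

open import Defs
open import Level using (0ℓ)
open import Data.Bool using (Bool; true; false; _∨_)
import Data.Bool.Properties as Bool
open import Data.Nat using (ℕ; zero; suc; _+_; _≤_; _<_; _⊔_; z≤n; s≤s)
open import Data.Nat.Properties
open import Data.Nat.InfinitelyOften using (Inf; commutes-with-∪; up; witness) renaming (map to Inf-map)
open import Data.Fin using (Fin; toℕ) renaming (zero to fzero; suc to fsuc)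
open import Data.Fin.Properties using (toℕ-injective; toℕ<n)
open import Data.Vec.Functional using ([]; _∷_)
open import Data.List as List using (List; length; lookup; map; [_])
open import Data.List.Relation.Unary.Any as Any using (Any; here)
open import Data.List.Relation.Unary.Any.Properties using (lookup-index)
open import Data.List.Membership.Propositional using (lose)
open import Data.List.Membership.Propositional.Properties using (∈-map⁺; ∈-lookup)
open import Data.Product using (Σ; ∃; _×_; _,_; proj₁; proj₂)
open import Data.Sum using (_⊎_; inj₁; inj₂; [_,_]′; swap)
open import Data.Unit using (⊤; tt)
open import Data.Empty using (⊥-elim)
open import Relation.Nullary using (Dec; yes; no; ¬_; does)
open import Relation.Nullary.Decidable using (decidable-stable)
open import Relation.Unary using (Pred; _⊆_; _∪_)
open import Relation.Binary using (tri<; tri≈; tri>)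
open import Relation.Binary.PropositionalEquality using (_≡_; refl; sym; trans; cong; subst; subst₂)
open import Relation.Binary.Structures using (IsPartialOrder)
open import Function using (_↔_; _⇔_; Inverse; Equivalence; mk↔ₛ′; mk⇔; _∘_)
open import Function.Definitions using (Injective)
open import Function.Construct.Identity using (↔-id; ⇔-id)
open import Axiom.UniquenessOfIdentityProofs using (module Decidable⇒UIP)

module _ {a ℓ} {A : Set a} (_R_ : A → A → Set ℓ) (R-trans : ∀ {x y z} → x R y → y R z → x R z)
         (q : ℕ → A) (step : ∀ j → q j R q (suc j)) where

  stepwise⇒<-mono : ∀ {i j} → i < j → q i R q j
  stepwise⇒<-mono {i} {suc j} (s≤s i≤j) with m≤n⇒m<n∨m≡n i≤j
  ... | inj₁ i<j  = R-trans (stepwise⇒<-mono i<j) (step j)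
  ... | inj₂ refl = step i

  stepwise⇒mono : (∀ {x} → x R x) → ∀ {i j} → i ≤ j → q i R q j
  stepwise⇒mono R-refl i≤j with m≤n⇒m<n∨m≡n i≤j
  ... | inj₁ i<j  = stepwise⇒<-mono i<j
  ... | inj₂ refl = R-refl

increasing⇒inflationary : (g : ℕ → ℕ) → (∀ j → g j < g (suc j)) → ∀ j → j ≤ g j
increasing⇒inflationary g inc zero    = z≤n
increasing⇒inflationary g inc (suc j) = ≤-<-trans (increasing⇒inflationary g inc j) (inc j)

Least : ∀ {ℓ} → Pred ℕ ℓ → ℕ → Set ℓ
Least A k = A k × (∀ j → j < k → ¬ A j)

Least-unique : ∀ {ℓ} {A : Pred ℕ ℓ} {k k′} → Least A k → Least A k′ → k ≡ k′
Least-unique {k = k} {k′} (Ak , below) (Ak′ , below′) with <-cmp k k′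
... | tri< k<k′ _ _ = ⊥-elim (below′ k k<k′ Ak)
... | tri≈ _ k≡k′ _ = k≡k′
... | tri> _ _ k′<k = ⊥-elim (below k′ k′<k Ak′)

Inf-all : Inf {0ℓ} (λ _ → ⊤)
Inf-all (i , never) = never i ≤-refl tt

module _ (lem : (Q : Set) → Dec Q) where

  least : {A : Pred ℕ 0ℓ} → ∀ K → A K → ∃ (Least A)
  least zero A0 = 0 , A0 , λ _ ()
  least {A} (suc K) AK with lem (A 0)
  ... | yes A0 = 0 , A0 , λ _ ()
  ... | no ¬A0 =
    let k , Ak , below = least {A ∘ suc} K AK
    in suc k , Ak , λ { zero _ → ¬A0 ; (suc j) (s≤s j<k) → below j j<k }

  ε : {A : Set} → A → (A → Set) → A
  ε x₀ Q with lem (∃ Q)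
  ... | yes (x , _) = x
  ... | no _        = x₀

  ε-spec : {A : Set} (x₀ : A) (Q : A → Set) → ∃ Q → Q (ε x₀ Q)
  ε-spec x₀ Q q with lem (∃ Q)
  ... | yes (_ , Qx) = Qx
  ... | no ¬q        = ⊥-elim (¬q q)

  Inf-witness : {A : Pred ℕ 0ℓ} → Inf A → ∀ b → ∃ λ a → b < a × A a
  Inf-witness inf b =
    let a , Aa = decidable-stable (lem _) (witness (up (suc b) inf))
    in suc b + a , s≤s (m≤m+n b a) , Aa

  pigeonhole : ∀ m {A : Pred ℕ 0ℓ} (f : ℕ → ℕ) → (∀ {a} → A a → f a < m) → Inf A →
               ∃ λ χ → Inf (λ a → A a × f a ≡ χ)
  pigeonhole zero    f bounded inf = ⊥-elim (inf (0 , λ _ _ Aa → n≮0 (bounded Aa)))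
  pigeonhole (suc m) {A} f bounded inf =
    [ (λ inf-m → m , inf-m) , below-m ]′
      (decidable-stable (lem _) (commutes-with-∪ (Inf-map split inf)))
    where
    split : A ⊆ (λ a → A a × f a ≡ m) ∪ (λ a → A a × ¬ f a ≡ m)
    split {a} Aa with f a ≟ m
    ... | yes fa≡m = inj₁ (Aa , fa≡m)
    ... | no fa≢m  = inj₂ (Aa , fa≢m)

    below-m : Inf (λ a → A a × ¬ f a ≡ m) → ∃ λ χ → Inf (λ a → A a × f a ≡ χ)
    below-m inf-other =
      let χ , inf-χ = pigeonhole m f (λ (Aa , fa≢m) → ≤∧≢⇒< (≤-pred (bounded Aa)) fa≢m) inf-other
      in χ , Inf-map (λ ((Aa , _) , fa≡χ) → Aa , fa≡χ) inf-χ

  -- Each stage holds an infinite set all of whose elements see the point of every earlier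
  -- stage in that stage's colour; the next point is taken from that set.
  module RamseyConstruction (m : ℕ) (col : ℕ → ℕ → ℕ) (col< : ∀ i j → col i j < m) where

    record Stage : Set₁ where
      field
        point    : ℕ
        rest     : Pred ℕ 0ℓ
        rest-inf : Inf rest

      colouring : ∃ λ χ → Inf (λ a → rest a × col point a ≡ χ)
      colouring = pigeonhole m (col point) (λ {a} _ → col< point a) rest-inf

      colour : ℕ
      colour = proj₁ colouring

      next-point : ∃ λ a → point < a × (rest a × col point a ≡ colour)
      next-point = Inf-witness (proj₂ colouring) point

    open Stage

    stage : ℕ → Stage
    stage zero    = record { point = 0 ; rest = λ _ → ⊤ ; rest-inf = Inf-all }
    stage (suc k) = record
      { point    = proj₁ (next-point (stage k))
      ; rest     = λ a → rest (stage k) a × col (point (stage k)) a ≡ colour (stage k)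
      ; rest-inf = proj₂ (colouring (stage k))
      }

    h : ℕ → ℕ
    h = point ∘ stage

    h-step : ∀ k → h k < h (suc k)
    h-step k = proj₁ (proj₂ (next-point (stage k)))

    rest-antitone : ∀ {k l} → k ≤ l → rest (stage l) ⊆ rest (stage k)
    rest-antitone =
      stepwise⇒mono (λ X Y → Y ⊆ X) (λ Y⊆X Z⊆Y z → Y⊆X (Z⊆Y z)) (rest ∘ stage) (λ k → proj₁) (λ x → x)

    h-colour : ∀ {k l} → k < l → col (h k) (h l) ≡ colour (stage k)
    h-colour {k} {suc l} k<1+l = proj₂ (rest-antitone k<1+l (proj₂ (proj₂ (next-point (stage l)))))

  ramsey : ∀ m (col : ℕ → ℕ → ℕ) → (∀ i j → col i j < m) →
           ∃ λ (g : ℕ → ℕ) → ∃ λ χ → (∀ j → g j < g (suc j)) × (∀ j → col (g j) (g (suc j)) ≡ χ)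
  ramsey m col col< =
    h ∘ idx , χ , (λ j → h-mono (idx-step j)) , λ j → trans (h-colour (idx-step j)) (idx-colour j)
    where
    open RamseyConstruction m col col<

    c : ℕ → ℕ
    c = Stage.colour ∘ stage

    homogeneous : ∃ λ χ → Inf (λ k → ⊤ × c k ≡ χ)
    homogeneous = pigeonhole m c (λ {k} _ → subst (_< m) (h-colour (n<1+n k)) (col< _ _)) Inf-all

    χ : ℕ
    χ = proj₁ homogeneous

    pick : ∀ b → ∃ λ a → b < a × (⊤ × c a ≡ χ)
    pick = Inf-witness (proj₂ homogeneous)

    idx : ℕ → ℕ
    idx zero    = proj₁ (pick 0)
    idx (suc j) = proj₁ (pick (idx j))

    idx-step : ∀ j → idx j < idx (suc j)
    idx-step j = proj₁ (proj₂ (pick (idx j)))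

    idx-colour : ∀ j → c (idx j) ≡ χ
    idx-colour zero    = proj₂ (proj₂ (proj₂ (pick 0)))
    idx-colour (suc j) = proj₂ (proj₂ (proj₂ (pick (idx j))))

    h-mono : ∀ {i j} → i < j → h i < h j
    h-mono = stepwise⇒<-mono _<_ <-trans h h-step

-- Cantor's zig-zag enumeration of ℕ × ℕ.
unpair : ℕ → ℕ × ℕ
unpair zero = 0 , 0
unpair (suc n) with unpair n
... | zero  , j = suc j , 0
... | suc i , j = i , suc j

unpair-step : ∀ {n i j} → unpair n ≡ (suc i , j) → unpair (suc n) ≡ (i , suc j)
unpair-step eq rewrite eq = refl

unpair-wrap : ∀ {n j} → unpair n ≡ (0 , j) → unpair (suc n) ≡ (suc j , 0)
unpair-wrap eq rewrite eq = refl

unpair-descend : ∀ j {i n} → unpair n ≡ (j + i , 0) → unpair (j + n) ≡ (i , j)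
unpair-descend zero    eq = eq
unpair-descend (suc j) {i} {n} eq =
  unpair-step {j + n} (unpair-descend j {suc i} {n} (trans eq (cong (_, 0) (sym (+-suc j i)))))

unpair-axis : ∀ i → ∃ λ n → unpair n ≡ (i , 0)
unpair-axis zero    = 0 , refl
unpair-axis (suc i) =
  let n , eq = unpair-axis i
  in suc (i + n) ,
     unpair-wrap {i + n} (unpair-descend i {0} {n} (trans eq (cong (_, 0) (sym (+-identityʳ i)))))

unpair-surjective : ∀ i j → ∃ λ n → unpair n ≡ (i , j)
unpair-surjective i j = let n , eq = unpair-axis (j + i) in j + n , unpair-descend j {i} {n} eq

IsMeet-unique : (S : Tree) → ∀ {a b m m′} → IsMeet S a b m → IsMeet S a b m′ → m ≡ m′
IsMeet-unique S (m≤a , m≤b , m-greatest) (m′≤a , m′≤b , m′-greatest) =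
  IsPartialOrder.antisym (Tree.isPartialOrder S) (m′-greatest _ m≤a m≤b) (m-greatest _ m′≤a m′≤b)

completion-countable : ∀ {T S e} → IsRamificationCompletion T S e →
                       Countable (|C| T) → Countable (|C| S)
completion-countable {T} {S} {e} completion (code , code-injective) = encode , encode-injective
  where
  open IsRamificationCompletion completion

  encode : |C| S → ℕ
  encode s = let x , y , _ = generated s in proj₁ (unpair-surjective (code x) (code y))

  encode-injective : Injective _≡_ _≡_ encode
  encode-injective {s} {t} eq =
    let xₛ , yₛ , s-meet = generated s
        xₜ , yₜ , t-meet = generated t
        codes = trans (sym (proj₂ (unpair-surjective (code xₛ) (code yₛ))))
                      (trans (cong unpair eq) (proj₂ (unpair-surjective (code xₜ) (code yₜ))))
    in IsMeet-unique S s-meet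
         (subst₂ (λ x y → IsMeet S (e x) (e y) t)
                 (sym (code-injective (cong proj₁ codes)))
                 (sym (code-injective (cong proj₂ codes)))
                 t-meet)

empty-aleph0Categorical : {A : Set} (_<_ : A → A → Set) (P : A → Set) → ¬ A → Aleph0Categorical A _<_ P
empty-aleph0Categorical {A} _ _ ¬A zero =
  [ (λ ()) ] , λ _ → ↔-id A , ((λ _ _ → ⇔-id _) , λ _ → ⇔-id _) , here (λ ())
empty-aleph0Categorical _ _ ¬A (suc n) = List.[] , λ a → ⊥-elim (¬A (a fzero))

module Automorphisms (S : Tree) (P : |C| S → Set) where
  open Tree S renaming (_≤_ to _⊑_; _<_ to _⊏_)
  open IsPartialOrder isPartialOrder using () renaming (refl to ⊑-refl)

  record Aut : Set where
    field
      to from   : Carrier → Carrier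
      from∘to   : ∀ x → from (to x) ≡ x
      to∘from   : ∀ y → to (from y) ≡ y
      to-mono   : ∀ {x y} → x ⊑ y → to x ⊑ to y
      from-mono : ∀ {x y} → x ⊑ y → from x ⊑ from y
      to-P      : ∀ {x} → P x → P (to x)
      from-P    : ∀ {x} → P x → P (from x)

    from-inverts : ∀ {x y} → to x ≡ y → from y ≡ x
    from-inverts {x} eq = trans (cong from (sym eq)) (from∘to x)

    to-reflects : ∀ {x y} → to x ⊑ to y → x ⊑ y
    to-reflects {x} {y} le = subst₂ _⊑_ (from∘to x) (from∘to y) (from-mono le)

    to-strict : ∀ {x y} → x ⊏ y → to x ⊏ to y
    to-strict (x⊑y , x≢y) = to-mono x⊑y , λ eq → x≢y (trans (sym (from-inverts eq)) (from-inverts refl))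

  _⁻¹ : Aut → Aut
  ρ ⁻¹ = record
    { to = from ; from = to ; from∘to = to∘from ; to∘from = from∘to
    ; to-mono = from-mono ; from-mono = to-mono ; to-P = from-P ; from-P = to-P }
    where open Aut ρ

  _∘ᴬ_ : Aut → Aut → Aut
  ρ ∘ᴬ τ = record
    { to        = ρ.to ∘ τ.to
    ; from      = τ.from ∘ ρ.from
    ; from∘to   = λ x → trans (cong τ.from (ρ.from∘to (τ.to x))) (τ.from∘to x)
    ; to∘from   = λ y → trans (cong ρ.to (τ.to∘from (ρ.from y))) (ρ.to∘from y)
    ; to-mono   = ρ.to-mono ∘ τ.to-mono
    ; from-mono = τ.from-mono ∘ ρ.from-mono
    ; to-P      = ρ.to-P ∘ τ.to-P
    ; from-P    = τ.from-P ∘ ρ.from-P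
    }
    where
    module ρ = Aut ρ
    module τ = Aut τ

  _∼_ : ∀ {n} → (Fin n → Carrier) → (Fin n → Carrier) → Set
  a ∼ b = Σ Aut λ ρ → ∀ i → Aut.to ρ (a i) ≡ b i

  ∼-sym : ∀ {n} {a b : Fin n → Carrier} → a ∼ b → b ∼ a
  ∼-sym (ρ , maps) = ρ ⁻¹ , λ i → Aut.from-inverts ρ (maps i)

  ∼-trans : ∀ {n} {a b c : Fin n → Carrier} → a ∼ b → b ∼ c → a ∼ c
  ∼-trans (ρ , a↦b) (τ , b↦c) = τ ∘ᴬ ρ , λ i → trans (cong (Aut.to τ) (a↦b i)) (b↦c i)

  module _ (lem : (Q : Set) → Dec Q) where

    fromIsAutomorphism : (σ : Carrier ↔ Carrier) → IsAutomorphism _⊏_ P σ → Aut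
    fromIsAutomorphism σ (order , colour) = record
      { to        = to
      ; from      = from
      ; from∘to   = strictlyInverseʳ
      ; to∘from   = strictlyInverseˡ
      ; to-mono   = mono (λ {x} {y} → Equivalence.to (order x y))
      ; from-mono = mono from-strict
      ; to-P      = λ {x} → Equivalence.to (colour x)
      ; from-P    = λ {x} Px → Equivalence.from (colour (from x)) (subst P (sym (strictlyInverseˡ x)) Px)
      }
      where
      open Inverse σ

      mono : {f : Carrier → Carrier} → (∀ {x y} → x ⊏ y → f x ⊏ f y) → ∀ {x y} → x ⊑ y → f x ⊑ f y
      mono f-strict {x} {y} x⊑y with lem (x ≡ y)
      ... | yes refl = ⊑-refl
      ... | no x≢y   = proj₁ (f-strict (x⊑y , x≢y))

      from-strict : ∀ {x y} → x ⊏ y → from x ⊏ from y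
      from-strict {x} {y} x⊏y =
        Equivalence.from (order (from x) (from y))
          (subst₂ _⊏_ (sym (strictlyInverseˡ x)) (sym (strictlyInverseˡ y)) x⊏y)

    module Representatives (categorical : Aleph0Categorical Carrier _⊏_ P) where

      reps : ∀ n → List (Fin n → Carrier)
      reps n = proj₁ (categorical n)

      classify : ∀ {n} (a : Fin n → Carrier) → Σ (Fin (length (reps n))) λ t → a ∼ lookup (reps n) t
      classify {n} a =
        let σ , aut , hit = proj₂ (categorical n) a
        in Any.index hit , fromIsAutomorphism σ aut , lookup-index hit

      classify-∼ : ∀ {n} {a b : Fin n → Carrier} → proj₁ (classify a) ≡ proj₁ (classify b) → a ∼ b
      classify-∼ {n} {a} {b} same =
        ∼-trans (proj₂ (classify a))
                (∼-sym (subst (λ t → b ∼ lookup (reps n) t) (sym same) (proj₂ (classify b))))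

module MaximalChain (lem : (Q : Set) → Dec Q) (S : Tree) (P : |C| S → Set)
                    (L : |C| S → Bool) (maximal : IsMaximalChain S L) where
  open Tree S renaming (_≤_ to _⊑_; _<_ to _⊏_)
  open IsPartialOrder isPartialOrder using ()
    renaming (refl to ⊑-refl; trans to ⊑-trans; antisym to ⊑-antisym)
  open Automorphisms S P

  SC : Set
  SC = SubCarrier S L

  InL : Carrier → Set
  InL x = L x ≡ true

  SC-≡ : {u v : SC} → proj₁ u ≡ proj₁ v → u ≡ v
  SC-≡ {x , p} {.x , q} refl = cong (x ,_) (Decidable⇒UIP.≡-irrelevant Bool._≟_ p q)

  comparable : ∀ {x y} → InL x → InL y → x ⊑ y ⊎ y ⊑ x
  comparable = proj₁ maximal _ _

  ⋢⇒⊐ : ∀ {x y} → InL x → InL y → ¬ x ⊑ y → y ⊏ x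
  ⋢⇒⊐ x∈L y∈L x⋢y with comparable x∈L y∈L
  ... | inj₁ x⊑y = ⊥-elim (x⋢y x⊑y)
  ... | inj₂ y⊑x = y⊑x , λ { refl → x⋢y ⊑-refl }

  ⊑-⊏-trans : ∀ {x y z} → x ⊑ y → y ⊏ z → x ⊏ z
  ⊑-⊏-trans x⊑y (y⊑z , y≢z) = ⊑-trans x⊑y y⊑z , λ { refl → y≢z (⊑-antisym y⊑z x⊑y) }

  upper-bound : ∀ {x y} → InL x → InL y → ∃ λ z → InL z × x ⊑ z × y ⊑ z
  upper-bound {x} {y} x∈L y∈L with comparable x∈L y∈L
  ... | inj₁ x⊑y = y , y∈L , x⊑y , ⊑-refl
  ... | inj₂ y⊑x = x , x∈L , ⊑-refl , y⊑x

  -- L ∪ {x} is again a chain, so maximality puts x in L.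
  downward-closed : ∀ {x y} → x ⊑ y → InL y → InL x
  downward-closed {x} {y} x⊑y y∈L =
    proj₂ maximal L+x L+x-chain (λ w w∈L → cong (_∨ _) w∈L) x x∈L+x
    where
    L+x : Carrier → Bool
    L+x w = L w ∨ does (lem (w ≡ x))

    members : ∀ w → L+x w ≡ true → InL w ⊎ w ≡ x
    members w _  with L w | lem (w ≡ x)
    members w _  | true  | _       = inj₁ refl
    members w _  | false | yes w≡x = inj₂ w≡x
    members w () | false | no _

    x∈L+x : L+x x ≡ true
    x∈L+x with lem (x ≡ x)
    ... | yes _  = Bool.∨-zeroʳ (L x)
    ... | no x≢x = ⊥-elim (x≢x refl)

    comparable-x : ∀ {z} → InL z → z ⊑ x ⊎ x ⊑ z
    comparable-x z∈L with comparable z∈L y∈L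
    ... | inj₁ z⊑y = downChain _ _ _ z⊑y x⊑y
    ... | inj₂ y⊑z = inj₂ (⊑-trans x⊑y y⊑z)

    L+x-chain : IsChain S L+x
    L+x-chain a b a∈ b∈ with members a a∈ | members b b∈
    ... | inj₁ a∈L | inj₁ b∈L = comparable a∈L b∈L
    ... | inj₁ a∈L | inj₂ refl = comparable-x a∈L
    ... | inj₂ refl | inj₁ b∈L = swap (comparable-x b∈L)
    ... | inj₂ refl | inj₂ refl = inj₁ ⊑-refl

  record CofinalSequence : Set where
    field
      at      : ℕ → Carrier
      at∈L    : ∀ j → InL (at j)
      step    : ∀ j → at j ⊑ at (suc j)
      cofinal : ∀ {y} → InL y → ∃ λ j → y ⊑ at j

    mono : ∀ {i j} → i ≤ j → at i ⊑ at j
    mono = stepwise⇒mono _⊑_ ⊑-trans at step ⊑-refl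

    bound : ∀ {n} (a : Fin n → SC) → ∃ λ K → ∀ i → proj₁ (a i) ⊑ at K
    bound {zero}  a = 0 , λ ()
    bound {suc n} a =
      let K , a⊑ = bound (a ∘ fsuc)
          j , a₀⊑ = cofinal (proj₂ (a fzero))
      in K ⊔ j , λ { fzero → ⊑-trans a₀⊑ (mono (m≤n⊔m K j))
                   ; (fsuc i) → ⊑-trans (a⊑ i) (mono (m≤m⊔n K j)) }

  open CofinalSequence using (at∈L; cofinal; mono)

  infix 30 _⟨_⟩
  _⟨_⟩ : CofinalSequence → ℕ → Carrier
  q ⟨ j ⟩ = CofinalSequence.at q j

  subsequence : CofinalSequence → (g : ℕ → ℕ) → (∀ j → g j < g (suc j)) → CofinalSequence
  subsequence q g inc = record
    { at      = (q ⟨_⟩) ∘ g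
    ; at∈L    = at∈L q ∘ g
    ; step    = λ j → mono q (<⇒≤ (inc j))
    ; cofinal = λ y∈L → let j , y⊑ = cofinal q y∈L in
                         j , ⊑-trans y⊑ (mono q (increasing⇒inflationary g inc j))
    }

  shift : CofinalSequence → ℕ → CofinalSequence
  shift q K = subsequence q (_+ K) (λ j → n<1+n (j + K))

  countable⇒cofinalSequence : Countable Carrier → SC → CofinalSequence
  countable⇒cofinalSequence (code , code-injective) (x₀ , x₀∈L) = record
    { at      = proj₁ ∘ point
    ; at∈L    = proj₂ ∘ point
    ; step    = λ n → proj₁ (proj₂ (proj₂ (raise n (proj₂ (point n)))))
    ; cofinal = λ {y} y∈L → suc (code y) , proj₂ (proj₂ (proj₂ (raise (code y) _))) y∈L refl
    }
    where
    raise : ∀ n {x} → InL x → ∃ λ x′ → InL x′ × x ⊑ x′ × (∀ {s} → InL s → code s ≡ n → s ⊑ x′)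
    raise n {x} x∈L with lem (∃ λ s → InL s × code s ≡ n)
    ... | yes (s , s∈L , s↦n) =
      let z , z∈L , x⊑z , s⊑z = upper-bound x∈L s∈L
      in z , z∈L , x⊑z , λ _ s′↦n → subst (_⊑ z) (code-injective (trans s↦n (sym s′↦n))) s⊑z
    ... | no nothing-coded = x , x∈L , ⊑-refl , λ s∈L s↦n → ⊥-elim (nothing-coded (_ , s∈L , s↦n))

    point : ℕ → SC
    point zero    = x₀ , x₀∈L
    point (suc n) = let x′ , x′∈L , _ = raise n (proj₂ (point n)) in x′ , x′∈L

  BlockOf : CofinalSequence → Carrier → ℕ → Set
  BlockOf q x = Least (λ k → x ⊑ q ⟨ k ⟩)

  blockOf : (q : CofinalSequence) → ∀ {x} → InL x → ∃ (BlockOf q x)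
  blockOf q x∈L = let j , x⊑ = cofinal q x∈L in least lem j x⊑

  -- φ k is used on the k-th block (c⟨k-1⟩, c⟨k⟩] ∩ L (block 0 being everything up to c⟨0⟩),
  -- which it carries onto the k-th block of d.
  record Gluing : Set where
    field
      c d     : CofinalSequence
      φ       : ℕ → Aut
      φ-base  : Aut.to (φ 0) (c ⟨ 0 ⟩) ≡ d ⟨ 0 ⟩
      φ-left  : ∀ j → Aut.to (φ (suc j)) (c ⟨ j ⟩) ≡ d ⟨ j ⟩
      φ-right : ∀ j → Aut.to (φ (suc j)) (c ⟨ suc j ⟩) ≡ d ⟨ suc j ⟩

  reverse : Gluing → Gluing
  reverse G = record
    { c       = d
    ; d       = c
    ; φ       = λ j → φ j ⁻¹
    ; φ-base  = Aut.from-inverts (φ 0) φ-base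
    ; φ-left  = λ j → Aut.from-inverts (φ (suc j)) (φ-left j)
    ; φ-right = λ j → Aut.from-inverts (φ (suc j)) (φ-right j)
    }
    where open Gluing G

  module Glued (G : Gluing) where
    open Gluing G
    open Aut using (to)

    φ-block : ∀ {x k} → BlockOf c x k → BlockOf d (to (φ k) x) k
    φ-block {k = zero}  (x⊑c₀ , _) = subst (_ ⊑_) φ-base (Aut.to-mono (φ 0) x⊑c₀) , λ _ ()
    φ-block {k = suc k} (x⊑c , below) =
      subst (_ ⊑_) (φ-right k) (Aut.to-mono (φ (suc k)) x⊑c) ,
      λ j j<1+k φx⊑d → below k (n<1+n k)
        (Aut.to-reflects (φ (suc k))
          (subst (_ ⊑_) (sym (φ-left k)) (⊑-trans φx⊑d (mono d (≤-pred j<1+k)))))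

    image∈L : ∀ {x k} → BlockOf c x k → InL (to (φ k) x)
    image∈L {k = k} b = downward-closed (proj₁ (φ-block b)) (at∈L d k)

    block-strict : ∀ {x y kx ky} → BlockOf c x kx → BlockOf c y ky → x ⊏ y →
                   to (φ kx) x ⊏ to (φ ky) y
    block-strict {x} {y} {kx} {ky} bx by x⊏y with <-cmp kx ky
    ... | tri≈ _ refl _ = Aut.to-strict (φ kx) x⊏y
    ... | tri< kx<ky _ _ = earlier kx<ky by
      where
      earlier : ∀ {ky} → kx < ky → BlockOf c y ky → to (φ kx) x ⊏ to (φ ky) y
      earlier {suc l} (s≤s kx≤l) by =
        ⊑-⊏-trans (⊑-trans (proj₁ (φ-block bx)) (mono d kx≤l))
                  (⋢⇒⊐ (image∈L by) (at∈L d l) (proj₂ (φ-block by) l (n<1+n l)))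
    ... | tri> _ _ ky<kx = ⊥-elim (later ky<kx bx)
      where
      later : ∀ {kx} → ky < kx → ¬ BlockOf c x kx
      later {suc l} (s≤s ky≤l) (_ , below) =
        below l (n<1+n l) (⊑-trans (proj₁ x⊏y) (⊑-trans (proj₁ by) (mono c ky≤l)))

    glue : ∀ {x} → InL x → Carrier
    glue {x} x∈L = to (φ (proj₁ (blockOf c x∈L))) x

    glue∈L : ∀ {x} (x∈L : InL x) → InL (glue x∈L)
    glue∈L x∈L = image∈L (proj₂ (blockOf c x∈L))

    glue-block : ∀ {x k} (x∈L : InL x) → BlockOf c x k → glue x∈L ≡ to (φ k) x
    glue-block {x} x∈L b = cong (λ k → to (φ k) x) (Least-unique (proj₂ (blockOf c x∈L)) b)

    glue-strict : ∀ {x y} (x∈L : InL x) (y∈L : InL y) → x ⊏ y → glue x∈L ⊏ glue y∈L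
    glue-strict x∈L y∈L = block-strict (proj₂ (blockOf c x∈L)) (proj₂ (blockOf c y∈L))

    glue-P : ∀ {x} (x∈L : InL x) → P x → P (glue x∈L)
    glue-P x∈L = Aut.to-P (φ (proj₁ (blockOf c x∈L)))

  glue-inverse : (G : Gluing) → ∀ {x} (x∈L : InL x) → Glued.glue (reverse G) (Glued.glue∈L G x∈L) ≡ x
  glue-inverse G {x} x∈L =
    let k , b = blockOf (Gluing.c G) x∈L
    in trans (Glued.glue-block (reverse G) (Glued.glue∈L G x∈L) (Glued.φ-block G b))
             (Aut.from∘to (Gluing.φ G k) x)

  glue-automorphism : (G : Gluing) →
    Σ (SC ↔ SC) λ σ → IsAutomorphism (SubLt S L) (SubPred S L P) σ ×
      (∀ {x} (x∈L : InL x) → x ⊑ Gluing.c G ⟨ 0 ⟩ →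
         proj₁ (Inverse.to σ (x , x∈L)) ≡ Aut.to (Gluing.φ G 0) x)
  glue-automorphism G = σ , (order , colour) , λ x∈L x⊑c₀ → F.glue-block x∈L (x⊑c₀ , λ _ ())
    where
    module F  = Glued G
    module F⁻¹ = Glued (reverse G)

    σ : SC ↔ SC
    σ = mk↔ₛ′ (λ (x , x∈L) → F.glue x∈L , F.glue∈L x∈L)
              (λ (y , y∈L) → F⁻¹.glue y∈L , F⁻¹.glue∈L y∈L)
              (λ (y , y∈L) → SC-≡ (glue-inverse (reverse G) y∈L))
              (λ (x , x∈L) → SC-≡ (glue-inverse G x∈L))

    order : ∀ u v → SubLt S L u v ⇔ SubLt S L (Inverse.to σ u) (Inverse.to σ v)
    order (x , x∈L) (y , y∈L) = mk⇔ (F.glue-strict x∈L y∈L) λ x′⊏y′ →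
      subst₂ _⊏_ (glue-inverse G x∈L) (glue-inverse G y∈L) (F⁻¹.glue-strict _ _ x′⊏y′)

    colour : ∀ u → SubPred S L P u ⇔ SubPred S L P (Inverse.to σ u)
    colour (x , x∈L) = mk⇔ (F.glue-P x∈L) λ Px′ → subst P (glue-inverse G x∈L) (F⁻¹.glue-P _ Px′)

  Homogeneous : CofinalSequence → Set
  Homogeneous q = ∀ u v → (q ⟨ u ⟩ ∷ q ⟨ suc u ⟩ ∷ []) ∼ (q ⟨ v ⟩ ∷ q ⟨ suc v ⟩ ∷ [])

  _∼ᴸ_ : ∀ {n} → (Fin n → SC) → (Fin n → SC) → Set
  a ∼ᴸ b = Σ (SC ↔ SC) λ σ → IsAutomorphism (SubLt S L) (SubPred S L P) σ ×
                             ∀ i → Inverse.to σ (a i) ≡ b i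

  module _ (e : CofinalSequence) (homogeneous : Homogeneous e) where

    orbit-extension : ∀ {n} (a b : Fin n → SC) K M → (∀ i → proj₁ (a i) ⊑ e ⟨ K ⟩) →
                      (e ⟨ K ⟩ ∷ proj₁ ∘ a) ∼ (e ⟨ M ⟩ ∷ proj₁ ∘ b) → a ∼ᴸ b
    orbit-extension a b K M a⊑ (ρ , ρ-maps) =
      let σ , aut , agrees = glue-automorphism G
      in σ , aut , λ i → SC-≡ (trans (agrees (proj₂ (a i)) (a⊑ i)) (ρ-maps (fsuc i)))
      where
      τ : ∀ j → (e ⟨ j + K ⟩ ∷ e ⟨ suc j + K ⟩ ∷ []) ∼ (e ⟨ j + M ⟩ ∷ e ⟨ suc j + M ⟩ ∷ [])
      τ j = homogeneous (j + K) (j + M)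

      φ : ℕ → Aut
      φ zero    = ρ
      φ (suc j) = proj₁ (τ j)

      G : Gluing
      G = record
        { c       = shift e K
        ; d       = shift e M
        ; φ       = φ
        ; φ-base  = ρ-maps fzero
        ; φ-left  = λ j → proj₂ (τ j) fzero
        ; φ-right = λ j → proj₂ (τ j) (fsuc fzero)
        }

  module _ (categorical : Aleph0Categorical Carrier _⊏_ P) where
    open Representatives lem categorical

    opaque
      homogeneous-subsequence : CofinalSequence → Σ CofinalSequence Homogeneous
      homogeneous-subsequence q =
        let g , _ , g-inc , same = ramsey lem (length (reps 2)) colour (λ i j → toℕ<n _)
        in subsequence q g g-inc ,
           λ u v → classify-∼ (toℕ-injective (trans (same u) (sym (same v))))
        where
        colour : ℕ → ℕ → ℕ
        colour i j = toℕ (proj₁ (classify (q ⟨ i ⟩ ∷ q ⟨ j ⟩ ∷ [])))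

    maximalChain-aleph0Categorical : Countable Carrier → Aleph0Categorical SC (SubLt S L) (SubPred S L P)
    maximalChain-aleph0Categorical countable with lem SC
    ... | no L-empty = empty-aleph0Categorical _ _ L-empty
    ... | yes x₀     = λ n → map (represent n) (reps (suc n)) , classifyᴸ n
      where
      e,homogeneous : Σ CofinalSequence Homogeneous
      e,homogeneous = homogeneous-subsequence (countable⇒cofinalSequence countable x₀)

      e : CofinalSequence
      e = proj₁ e,homogeneous

      Represents : ∀ {n} → (Fin (suc n) → Carrier) → (Fin n → SC) → Set
      Represents r b = ∃ λ M → (e ⟨ M ⟩ ∷ proj₁ ∘ b) ∼ r

      represent : ∀ n → (Fin (suc n) → Carrier) → Fin n → SC
      represent n r = ε lem (λ _ → x₀) (Represents r)

      classifyᴸ : ∀ n (a : Fin n → SC) →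
                  Σ (SC ↔ SC) λ σ → IsAutomorphism (SubLt S L) (SubPred S L P) σ ×
                    Any (λ b → ∀ i → Inverse.to σ (a i) ≡ b i) (map (represent n) (reps (suc n)))
      classifyᴸ n a =
        let K , a⊑ = CofinalSequence.bound e a
            t , a∼r = classify (e ⟨ K ⟩ ∷ proj₁ ∘ a)
            r = lookup (reps (suc n)) t
            M , b∼r = ε-spec lem (λ _ → x₀) (Represents r) (a , K , a∼r)
            σ , aut , maps = orbit-extension e (proj₂ e,homogeneous) a (represent n r) K M a⊑
                                             (∼-trans a∼r (∼-sym b∼r))
        in σ , aut , lose (∈-map⁺ (represent n) (∈-lookup {xs = reps (suc n)} t)) maps

lemma3p6 : (lem : (P : Set) → Dec P) →
           (T : Tree) → Countable (|C| T) →
           (S : Tree) (e : |C| T → |C| S) → IsRamificationCompletion T S e →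
           Aleph0Categorical (|C| S) (Tree._<_ S) (Irrational {T} {S} e) →
           (L : |C| S → Bool) → IsMaximalChain S L →
           Aleph0Categorical (SubCarrier S L) (SubLt S L) (SubPred S L (Irrational {T} {S} e))
lemma3p6 lem T countable S e completion categorical L maximal =
  MaximalChain.maximalChain-aleph0Categorical lem S (Irrational {T} {S} e) L maximal categorical
    (completion-countable completion countable)
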